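{- Let $\ell\ge2$ with binary power representation $\ell=\sum_{i=1}^k2^{n_i}$, $n_1>n_2>\cdots>n_k\ge0$. Then $R(F(\ell))=R(T_{\mathbf L})$, where $F(\ell)$ and $T_{\mathbf L}$ are the trees defined below.
   Context: All trees are rooted; $T(v)$ is the subtree induced by $v$ and its descendants; a leaf is a vertex with no children. The rank $R_T(v)$ is the minimum distance from $v$ to a leaf of $T(v)$, and the security is $R(T)=\sum_{v}R_T(v)$. A complete binary tree on $2^m$ leaves is the rooted tree in which every non-leaf vertex has exactly two children and all $2^m$ leaves are at distance $m$ from the root. $T_{\mathbf L}$ is rooted at $v_k$ and obtained from a path $v_1v_2\cdots v_k$ by identifying $v_1$ with the root of a complete binary tree on $2^{n_1}$ leaves and, for $2\le i\le k$, joining $v_i$ by an edge to the root of a new complete binary tree on $2^{n_i}$ leaves. $F(\ell)$ is constructed as follows: take a complete binary tree with $2^{\lfloor\log_2\ell\rfloor}$ leaves, drawn in the plane with its leaves listed from left to right as $\ell_1,\ell_2,\dots,\ell_{2^{\lfloor\log_2\ell\rfloor}}$; for each $1\le i\le \ell-2^{\lfloor\log_2\ell\rfloor}$, attach two new leaf children to $\ell_i$. -}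

module Defs where

open import Data.Nat using (ℕ; zero; suc; _+_; _∸_; _^_; _⊓_; _≤ᵇ_)
open import Data.Nat.Logarithm using (⌊log₂_⌋)
open import Data.List using (List; []; _∷_; foldl)
open import Data.Bool using (if_then_else_)

data Tree : Set where
  node : List Tree → Tree

leaf : Tree
leaf = node []

mutual
  rank : Tree → ℕ
  rank (node [])       = 0
  rank (node (c ∷ cs)) = suc (minRank (rank c) cs)

  minRank : ℕ → List Tree → ℕ
  minRank m []       = m
  minRank m (c ∷ cs) = minRank (m ⊓ rank c) cs

-- Security R(T): sum of ranks over all vertices.
mutual
  security : Tree → ℕ
  security (node cs) = rank (node cs) + securityList cs

  securityList : List Tree → ℕ
  securityList []       = 0
  securityList (c ∷ cs) = security c + securityList cs

cbt : ℕ → Tree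
cbt zero    = leaf
cbt (suc m) = node (cbt m ∷ cbt m ∷ [])

-- Complete binary tree with 2^m leaves in which each of the leftmost
-- r leaves (in left-to-right order) receives two new leaf children.
cbtAttach : ℕ → ℕ → Tree
cbtAttach zero r    = if 1 ≤ᵇ r then node (leaf ∷ leaf ∷ []) else leaf
cbtAttach (suc m) r = node (cbtAttach m (r ⊓ 2 ^ m) ∷ cbtAttach m (r ∸ 2 ^ m) ∷ [])

F : ℕ → Tree
F ℓ = cbtAttach ⌊log₂ ℓ ⌋ (ℓ ∸ 2 ^ ⌊log₂ ℓ ⌋)

-- T_L for L = (n₁, n₂, …, n_k) given as n₁ and the list (n₂ … n_k):
-- v₁ is the root of cbt n₁; v_i has children v_{i-1} and the root of cbt n_i;
-- the tree is rooted at v_k.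
T-L : ℕ → List ℕ → Tree
T-L n₁ ns = foldl (λ t n → node (t ∷ cbt n ∷ [])) (cbt n₁) ns

sumPow2 : List ℕ → ℕ
sumPow2 []       = 0
sumPow2 (n ∷ ns) = 2 ^ n + sumPow2 ns

{-# OPTIONS --safe #-}
module Submission where

open import Defs
open import Data.Nat using (ℕ; _≤_; _>_)
open import Data.List using (List; _∷_)
open import Data.List.Relation.Unary.Linked using (Linked)
open import Relation.Binary.PropositionalEquality using (_≡_)

open import Data.Nat using (zero; suc; _+_; _∸_; _^_; _⊓_; _<_; z≤n; s≤s; s≤s⁻¹; z<s; s<s; ⌊_/2⌋)
open import Data.Nat.Properties
open import Data.Nat.Logarithm using (⌊log₂_⌋; ⌊log₂⌋-mono-≤; ⌊log₂⌊n/2⌋⌋≡⌊log₂n⌋∸1; ⌊log₂[2^n]⌋≡n)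
open import Data.Nat.Tactic.RingSolver using (solve-∀)
open import Data.List using ([]; foldl)
open import Data.List.Relation.Unary.Linked using (_∷_)
open import Data.Sum using (inj₁; inj₂)
open import Relation.Binary.PropositionalEquality using (refl; sym; trans; cong; cong₂; subst; module ≡-Reasoning)

-- Both securities equal R(cbt n₁) + Σ_{i ≥ 2} (R(cbt n_i) + n_i + 1).
-- In T_L the exponents decrease, so v_i has rank n_i + 1 and adds that rank
-- plus the security of its pendant cbt n_i. F(ℓ) is cbt n₁ with its leftmost
-- r = Σ_{i ≥ 2} 2^{n_i} < 2^{n₁} leaves extended; since r < 2^{n₁} the rightmost
-- leaf is untouched, so the root keeps rank n₁. Recursing on cbt (m + 1): if
-- n₂ = m the left half becomes cbt (m + 1), an excess of R(cbt m) + m + 1 over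
-- cbt m, and the remaining extensions go to the right half; if n₂ < m they all
-- go to the left half.

branchSecurity : List ℕ → ℕ
branchSecurity []       = 0
branchSecurity (n ∷ ns) = security (cbt n) + suc n + branchSecurity ns

security-node₂ : ∀ a b → security (node (a ∷ b ∷ [])) ≡ rank (node (a ∷ b ∷ [])) + security a + security b
security-node₂ a b =
  trans (cong (λ s → ρ + (security a + s)) (+-identityʳ (security b))) (sym (+-assoc ρ (security a) (security b)))
  where
  ρ : ℕ
  ρ = rank (node (a ∷ b ∷ []))

rank-cbt : ∀ n → rank (cbt n) ≡ n
rank-cbt zero    = refl
rank-cbt (suc n) = cong suc (trans (cong₂ _⊓_ (rank-cbt n) (rank-cbt n)) (⊓-idem n))

security-cbt-suc : ∀ m → security (cbt (suc m)) ≡ suc m + security (cbt m) + security (cbt m)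
security-cbt-suc m = trans (security-node₂ (cbt m) (cbt m))
                           (cong (λ k → k + security (cbt m) + security (cbt m)) (rank-cbt (suc m)))

2^[1+n]≡2^n+2^n : ∀ n → 2 ^ suc n ≡ 2 ^ n + 2 ^ n
2^[1+n]≡2^n+2^n n = cong (2 ^ n +_) (+-identityʳ (2 ^ n))

sumPow2< : ∀ {m ns} → Linked _>_ (m ∷ ns) → sumPow2 ns < 2 ^ m
sumPow2< {m} {[]}     _           = m^n>0 2 m
sumPow2< {m} {n ∷ ns} (n<m ∷ lk) = begin-strict
  2 ^ n + sumPow2 ns <⟨ +-monoʳ-< (2 ^ n) (sumPow2< lk) ⟩
  2 ^ n + 2 ^ n      ≡⟨ 2^[1+n]≡2^n+2^n n ⟨
  2 ^ suc n          ≤⟨ ^-monoʳ-≤ 2 n<m ⟩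
  2 ^ m              ∎
  where open ≤-Reasoning

cbtAttach-zero : ∀ m → cbtAttach m 0 ≡ cbt m
cbtAttach-zero zero    = refl
cbtAttach-zero (suc m) =
  cong₂ (λ a b → node (a ∷ b ∷ []))
    (cbtAttach-zero m)
    (trans (cong (cbtAttach m) (0∸n≡0 (2 ^ m))) (cbtAttach-zero m))

cbtAttach-full : ∀ m → cbtAttach m (2 ^ m) ≡ cbt (suc m)
cbtAttach-full zero    = refl
cbtAttach-full (suc m) =
  cong₂ (λ a b → node (a ∷ b ∷ []))
    (trans (cong (cbtAttach m) (m≥n⇒m⊓n≡n (m≤m+n (2 ^ m) (2 ^ m + 0)))) (cbtAttach-full m))
    (trans (cong (cbtAttach m) (trans (m+n∸m≡n (2 ^ m) (2 ^ m + 0)) (+-identityʳ (2 ^ m))))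
           (cbtAttach-full m))

m≤rank-cbtAttach : ∀ m r → m ≤ rank (cbtAttach m r)
m≤rank-cbtAttach zero    r = z≤n
m≤rank-cbtAttach (suc m) r = s≤s (begin
  m     ≡⟨ ⊓-idem m ⟨
  m ⊓ m ≤⟨ ⊓-mono-≤ (m≤rank-cbtAttach m (r ⊓ 2 ^ m)) (m≤rank-cbtAttach m (r ∸ 2 ^ m)) ⟩
  rank (cbtAttach m (r ⊓ 2 ^ m)) ⊓ rank (cbtAttach m (r ∸ 2 ^ m)) ∎)
  where open ≤-Reasoning

rank-cbtAttach : ∀ m r → r < 2 ^ m → rank (cbtAttach m r) ≡ m
rank-cbtAttach zero    zero    _        = refl
rank-cbtAttach zero    (suc r) (s≤s ())
rank-cbtAttach (suc m) r       r<2^[1+m] = cong suc (begin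
  rank (cbtAttach m (r ⊓ 2 ^ m)) ⊓ rank (cbtAttach m (r ∸ 2 ^ m))
    ≡⟨ cong (rank (cbtAttach m (r ⊓ 2 ^ m)) ⊓_) (rank-cbtAttach m (r ∸ 2 ^ m) right<) ⟩
  rank (cbtAttach m (r ⊓ 2 ^ m)) ⊓ m
    ≡⟨ m≥n⇒m⊓n≡n (m≤rank-cbtAttach m (r ⊓ 2 ^ m)) ⟩
  m ∎)
  where
  open ≡-Reasoning
  right< : r ∸ 2 ^ m < 2 ^ m
  right< = m<n+o⇒m∸n<o r (2 ^ m) {{m^n≢0 2 m}} (subst (r <_) (2^[1+n]≡2^n+2^n m) r<2^[1+m])

security-cbtAttach-suc : ∀ m r → r < 2 ^ suc m →
  security (cbtAttach (suc m) r) ≡ suc m + security (cbtAttach m (r ⊓ 2 ^ m)) + security (cbtAttach m (r ∸ 2 ^ m))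
security-cbtAttach-suc m r r< =
  trans (security-node₂ (cbtAttach m (r ⊓ 2 ^ m)) (cbtAttach m (r ∸ 2 ^ m)))
        (cong (λ k → k + security (cbtAttach m (r ⊓ 2 ^ m)) + security (cbtAttach m (r ∸ 2 ^ m)))
              (rank-cbtAttach (suc m) r r<))

security-cbtAttach : ∀ m ns → Linked _>_ (m ∷ ns) →
  security (cbtAttach m (sumPow2 ns)) ≡ security (cbt m) + branchSecurity ns
security-cbtAttach zero    []       _ = refl
security-cbtAttach zero    (n ∷ ns) (() ∷ _)
security-cbtAttach (suc m) []       _ =
  trans (cong security (cbtAttach-zero (suc m))) (sym (+-identityʳ _))
security-cbtAttach (suc m) (n ∷ ns) lk@(s≤s n≤m ∷ lk′) with m≤n⇒m<n∨m≡n n≤m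
... | inj₂ refl = begin
  security (cbtAttach (suc m) r)
    ≡⟨ security-cbtAttach-suc m r (sumPow2< lk) ⟩
  suc m + security (cbtAttach m (r ⊓ 2 ^ m)) + security (cbtAttach m (r ∸ 2 ^ m))
    ≡⟨ cong₂ (λ a b → suc m + security (cbtAttach m a) + security (cbtAttach m b))
             (m≥n⇒m⊓n≡n (m≤m+n (2 ^ m) (sumPow2 ns))) (m+n∸m≡n (2 ^ m) (sumPow2 ns)) ⟩
  suc m + security (cbtAttach m (2 ^ m)) + security (cbtAttach m (sumPow2 ns))
    ≡⟨ cong₂ (λ a b → suc m + security a + b) (cbtAttach-full m) (security-cbtAttach m ns lk′) ⟩
  suc m + security (cbt (suc m)) + (security (cbt m) + branchSecurity ns)
    ≡⟨ rearrange (security (cbt (suc m))) (security (cbt m)) (branchSecurity ns) m ⟩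
  security (cbt (suc m)) + (security (cbt m) + suc m + branchSecurity ns) ∎
  where
  open ≡-Reasoning
  r = sumPow2 (m ∷ ns)
  rearrange : ∀ s t b m → suc m + s + (t + b) ≡ s + (t + suc m + b)
  rearrange = solve-∀
... | inj₁ n<m = begin
  security (cbtAttach (suc m) r)
    ≡⟨ security-cbtAttach-suc m r (sumPow2< lk) ⟩
  suc m + security (cbtAttach m (r ⊓ 2 ^ m)) + security (cbtAttach m (r ∸ 2 ^ m))
    ≡⟨ cong₂ (λ a b → suc m + security (cbtAttach m a) + security (cbtAttach m b))
             (m≤n⇒m⊓n≡m (<⇒≤ r<2^m)) (m≤n⇒m∸n≡0 (<⇒≤ r<2^m)) ⟩
  suc m + security (cbtAttach m r) + security (cbtAttach m 0)
    ≡⟨ cong₂ (λ a b → suc m + a + security b) (security-cbtAttach m (n ∷ ns) (n<m ∷ lk′)) (cbtAttach-zero m) ⟩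
  suc m + (security (cbt m) + branchSecurity (n ∷ ns)) + security (cbt m)
    ≡⟨ rearrange (security (cbt m)) (branchSecurity (n ∷ ns)) m ⟩
  suc m + security (cbt m) + security (cbt m) + branchSecurity (n ∷ ns)
    ≡⟨ cong (_+ branchSecurity (n ∷ ns)) (security-cbt-suc m) ⟨
  security (cbt (suc m)) + branchSecurity (n ∷ ns) ∎
  where
  open ≡-Reasoning
  r = sumPow2 (n ∷ ns)
  r<2^m : r < 2 ^ m
  r<2^m = sumPow2< (n<m ∷ lk′)
  rearrange : ∀ s b m → suc m + (s + b) + s ≡ suc m + s + s + b
  rearrange = solve-∀

attachCbt : Tree → ℕ → Tree
attachCbt t n = node (t ∷ cbt n ∷ [])

rank-attachCbt : ∀ t n → n < rank t → rank (attachCbt t n) ≡ suc n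
rank-attachCbt t n n<rank = cong suc (trans (cong (rank t ⊓_) (rank-cbt n)) (m≥n⇒m⊓n≡n (<⇒≤ n<rank)))

security-foldl-attachCbt : ∀ {m} t ns → m ≤ rank t → Linked _>_ (m ∷ ns) →
  security (foldl attachCbt t ns) ≡ security t + branchSecurity ns
security-foldl-attachCbt t []       _      _           = sym (+-identityʳ (security t))
security-foldl-attachCbt t (n ∷ ns) m≤rank (n<m ∷ lk) = begin
  security (foldl attachCbt (attachCbt t n) ns)
    ≡⟨ security-foldl-attachCbt (attachCbt t n) ns (subst (n ≤_) (sym rank-attach) (n≤1+n n)) lk ⟩
  security (attachCbt t n) + branchSecurity ns
    ≡⟨ cong (_+ branchSecurity ns) (security-node₂ t (cbt n)) ⟩
  rank (attachCbt t n) + security t + security (cbt n) + branchSecurity ns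
    ≡⟨ cong (λ k → k + security t + security (cbt n) + branchSecurity ns) rank-attach ⟩
  suc n + security t + security (cbt n) + branchSecurity ns
    ≡⟨ rearrange (security t) (security (cbt n)) (branchSecurity ns) n ⟩
  security t + (security (cbt n) + suc n + branchSecurity ns) ∎
  where
  open ≡-Reasoning
  rank-attach : rank (attachCbt t n) ≡ suc n
  rank-attach = rank-attachCbt t n (<-≤-trans n<m m≤rank)
  rearrange : ∀ t s b n → suc n + t + s + b ≡ t + (s + suc n + b)
  rearrange = solve-∀

⌊m/2⌋<n : ∀ m n → m < n + n → ⌊ m /2⌋ < n
⌊m/2⌋<n m             zero    ()
⌊m/2⌋<n zero          (suc n) _ = z<s
⌊m/2⌋<n (suc zero)    (suc n) _ = z<s
⌊m/2⌋<n (suc (suc m)) (suc n) lt =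
  s<s (⌊m/2⌋<n m n (s≤s⁻¹ (s≤s⁻¹ (subst (suc (suc (suc m)) ≤_) (cong suc (+-suc n n)) lt))))

m<2^[1+n]⇒⌊log₂m⌋≤n : ∀ n m → m < 2 ^ suc n → ⌊log₂ m ⌋ ≤ n
m<2^[1+n]⇒⌊log₂m⌋≤n zero    m m<2 = subst (⌊log₂ m ⌋ ≤_) (⌊log₂[2^n]⌋≡n 0) (⌊log₂⌋-mono-≤ (s≤s⁻¹ m<2))
m<2^[1+n]⇒⌊log₂m⌋≤n (suc n) m m<2^[2+n] = begin
  ⌊log₂ m ⌋           ≤⟨ m≤n+m∸n ⌊log₂ m ⌋ 1 ⟩
  1 + (⌊log₂ m ⌋ ∸ 1) ≡⟨ cong suc (⌊log₂⌊n/2⌋⌋≡⌊log₂n⌋∸1 m) ⟨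
  1 + ⌊log₂ ⌊ m /2⌋ ⌋ ≤⟨ s≤s (m<2^[1+n]⇒⌊log₂m⌋≤n n ⌊ m /2⌋ half<) ⟩
  1 + n               ∎
  where
  open ≤-Reasoning
  half< : ⌊ m /2⌋ < 2 ^ suc n
  half< = ⌊m/2⌋<n m (2 ^ suc n) (subst (m <_) (2^[1+n]≡2^n+2^n (suc n)) m<2^[2+n])

⌊log₂[2^n+m]⌋≡n : ∀ n m → m < 2 ^ n → ⌊log₂ (2 ^ n + m) ⌋ ≡ n
⌊log₂[2^n+m]⌋≡n n m m<2^n = ≤-antisym
  (m<2^[1+n]⇒⌊log₂m⌋≤n n (2 ^ n + m)
    (subst (2 ^ n + m <_) (sym (2^[1+n]≡2^n+2^n n)) (+-monoʳ-< (2 ^ n) m<2^n)))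
  (subst (_≤ ⌊log₂ (2 ^ n + m) ⌋) (⌊log₂[2^n]⌋≡n n) (⌊log₂⌋-mono-≤ (m≤m+n (2 ^ n) m)))

F-2^n+m : ∀ n m → m < 2 ^ n → F (2 ^ n + m) ≡ cbtAttach n m
F-2^n+m n m m<2^n rewrite ⌊log₂[2^n+m]⌋≡n n m m<2^n = cong (cbtAttach n) (m+n∸m≡n (2 ^ n) m)

proposition3p2 : (ℓ n₁ : ℕ) (ns : List ℕ) → 2 ≤ ℓ →
    Linked _>_ (n₁ ∷ ns) → ℓ ≡ sumPow2 (n₁ ∷ ns) →
    security (F ℓ) ≡ security (T-L n₁ ns)
proposition3p2 _ n₁ ns _ lk refl = begin
  security (F (2 ^ n₁ + sumPow2 ns))     ≡⟨ cong security (F-2^n+m n₁ (sumPow2 ns) (sumPow2< lk)) ⟩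
  security (cbtAttach n₁ (sumPow2 ns))   ≡⟨ security-cbtAttach n₁ ns lk ⟩
  security (cbt n₁) + branchSecurity ns  ≡⟨ security-foldl-attachCbt (cbt n₁) ns n₁≤rank lk ⟨
  security (T-L n₁ ns)                   ∎
  where
  open ≡-Reasoning
  n₁≤rank : n₁ ≤ rank (cbt n₁)
  n₁≤rank = ≤-reflexive (sym (rank-cbt n₁))
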